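{- For $\sigma=3$ and every $k\ge4$, no $(k,3)$-PdB-string exists.
   Context: Let $\Sigma=\{a_1<\dots<a_\sigma\}$. For a string $u$, $\mathbf{pv}(u)\in\mathbb{N}^\sigma$ has $i$-th entry the number of occurrences of $a_i$ in $u$; the order of a Parikh vector is the sum of its entries. A string $w$ over $\Sigma$ is a $(k,\sigma)$-PdB-string if for every Parikh vector $p\in\mathbb{N}^\sigma$ of order $k$ there is exactly one (occurrence of a) length-$k$ substring $u$ of $w$ with $\mathbf{pv}(u)=p$. -}

module Defs where

open import Data.Nat using (ℕ; zero; suc; _+_; _≤_)
open import Data.Fin using (Fin)
open import Data.List using (List; length; take; drop; filter)
open import Data.Vec using (Vec; tabulate)
open import Data.Vec as Vec using ()
open import Data.Product using (Σ; _×_; _,_)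
open import Data.Fin.Properties using (_≟_)
open import Relation.Binary.PropositionalEquality using (_≡_)

-- Alphabet Σ = {a_1 < ... < a_σ} is modelled as Fin σ (a_i ↦ i-1).
-- A string over Σ is a List (Fin σ).

count : ∀ {σ} → Fin σ → List (Fin σ) → ℕ
count a u = length (filter (_≟ a) u)

pv : ∀ {σ} → List (Fin σ) → Vec ℕ σ
pv u = tabulate (λ i → count i u)

order : ∀ {σ} → Vec ℕ σ → ℕ
order = Vec.sum

-- the length-k substring of w starting at position i (0-based);
-- it is a genuine substring occurrence when i + k ≤ length w
substr : ∀ {σ} → ℕ → ℕ → List (Fin σ) → List (Fin σ)
substr i k w = take k (drop i w)

OccursAt : ∀ {σ} → ℕ → List (Fin σ) → Vec ℕ σ → ℕ → Set
OccursAt k w p i = (i + k ≤ length w) × (pv (substr i k w) ≡ p)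

IsPdB : (k σ : ℕ) → List (Fin σ) → Set
IsPdB k σ w = (p : Vec ℕ σ) → order p ≡ k →
  Σ ℕ (λ i → OccursAt k w p i × ((j : ℕ) → OccursAt k w p j → j ≡ i))

-- Sliding a window one step removes the letter w[s] and adds w[s + K], so uniqueness of Parikh vectors
-- forces w[s] ≢ w[s + K]. Consequently, walking away from the all-x window ("corner") of a letter x,
-- each step loses one x while every other count grows by 0 or 1. Two such arms of different letters
-- must cross (a discrete intermediate value argument), and at a crossing the two windows share two
-- counts, hence their Parikh vector, hence they coincide. This pins the three corners to T, T + K,
-- T + 2K with fewer than K letters before T and after T + 3K. The windows containing both outer
-- letters then lie on the two outer arms, where the vectors with outer counts (2,2), (2,1), (1,1)
-- (or (2,2), (1,2), (1,1)) cannot all be placed.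
module Submission where

open import Defs
open import Data.Nat using (ℕ; zero; suc; _+_; _∸_; _⊓_; _≤_; _<_; z≤n; s≤s)
open import Data.Nat.Properties hiding (_≟_)
open import Data.Fin using (Fin; zero; suc)
open import Data.Fin.Properties using (_≟_)
open import Data.List using (List; []; _∷_; length; take; drop; filter; _++_)
open import Data.List.Properties using (length-take; length-drop; length-++; filter-++; length-filter)
open import Data.Product using (∃-syntax; _×_; _,_; proj₁; proj₂)
open import Data.Bool using (if_then_else_)
open import Data.Vec using (tabulate; lookup)
open import Data.Vec.Properties using (lookup∘tabulate; tabulate-cong)
open import Data.Sum using (_⊎_; inj₁; inj₂; [_,_]; swap)
open import Data.Empty using (⊥; ⊥-elim)
open import Relation.Nullary using (¬_; yes; no; does)
open import Relation.Nullary.Decidable using (dec-true; dec-false)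
open import Relation.Binary.PropositionalEquality hiding ([_])
open import Data.Nat.Tactic.RingSolver using (solve-∀)

δ : ∀ {σ} → Fin σ → Fin σ → ℕ
δ y a = count a (y ∷ [])

count-∷ : ∀ {σ} (a y : Fin σ) u → count a (y ∷ u) ≡ δ y a + count a u
count-∷ a y u with y ≟ a
... | yes _ = refl
... | no _ = refl

δ-refl : ∀ {σ} (a : Fin σ) → δ a a ≡ 1
δ-refl a with a ≟ a
... | yes _ = refl
... | no a≢a = ⊥-elim (a≢a refl)

δ-≢ : ∀ {σ} {a y : Fin σ} → y ≢ a → δ y a ≡ 0
δ-≢ {a = a} {y} y≢a with y ≟ a
... | yes y≡a = ⊥-elim (y≢a y≡a)
... | no _ = refl

δ≡0⊎δ≡1 : ∀ {σ} (y a : Fin σ) → δ y a ≡ 0 ⊎ δ y a ≡ 1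
δ≡0⊎δ≡1 y a with y ≟ a
... | yes _ = inj₂ refl
... | no _ = inj₁ refl

≡+δ⇒≡⊎≡suc : ∀ {σ m n} (b a : Fin σ) → m ≡ n + δ b a → m ≡ n ⊎ m ≡ suc n
≡+δ⇒≡⊎≡suc {n = n} b a m≡n+δ with δ≡0⊎δ≡1 b a
... | inj₁ e = inj₁ (trans m≡n+δ (trans (cong (n +_) e) (+-identityʳ n)))
... | inj₂ e = inj₂ (trans m≡n+δ (trans (cong (n +_) e) (+-comm n 1)))

count-++ : ∀ {σ} (a : Fin σ) u v → count a (u ++ v) ≡ count a u + count a v
count-++ a u v = trans (cong length (filter-++ (_≟ a) u v)) (length-++ (filter (_≟ a) u))

count-∷ʳ-slide : ∀ {σ} (a y b : Fin σ) u → count a (u ++ (b ∷ [])) + δ y a ≡ count a (y ∷ u) + δ b a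
count-∷ʳ-slide a y b u = begin
  count a (u ++ (b ∷ [])) + δ y a  ≡⟨ cong (_+ δ y a) (count-++ a u (b ∷ [])) ⟩
  count a u + δ b a + δ y a        ≡⟨ +-comm (count a u + δ b a) (δ y a) ⟩
  δ y a + (count a u + δ b a)      ≡⟨ +-assoc (δ y a) (count a u) (δ b a) ⟨
  δ y a + count a u + δ b a        ≡⟨ cong (_+ δ b a) (count-∷ a y u) ⟨
  count a (y ∷ u) + δ b a          ∎
  where open ≡-Reasoning

-- Junk value: the letter zero past the end of the list.
_!_ : ∀ {σ} → List (Fin (suc σ)) → ℕ → Fin (suc σ)
[] ! _ = zero
(x ∷ _) ! zero = x
(_ ∷ u) ! suc i = u ! i

drop-! : ∀ {σ} i j (u : List (Fin (suc σ))) → drop i u ! j ≡ u ! (i + j)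
drop-! zero j u = refl
drop-! (suc i) j [] = refl
drop-! (suc i) j (x ∷ u) = drop-! i j u

drop-∷ : ∀ {σ} i (u : List (Fin (suc σ))) → i < length u → drop i u ≡ u ! i ∷ drop (suc i) u
drop-∷ zero (x ∷ u) _ = refl
drop-∷ (suc i) (x ∷ u) (s≤s i<n) = drop-∷ i u i<n

take-suc : ∀ {σ} i (u : List (Fin (suc σ))) → i < length u → take (suc i) u ≡ take i u ++ (u ! i ∷ [])
take-suc zero (x ∷ u) _ = refl
take-suc (suc i) (x ∷ u) (s≤s i<n) = cong (x ∷_) (take-suc i u i<n)

take-! : ∀ {σ} {n j} (u : List (Fin (suc σ))) → j < n → take n u ! j ≡ u ! j
take-! {n = suc _} [] _ = refl
take-! {n = suc _} {zero} (x ∷ u) _ = refl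
take-! {n = suc _} {suc j} (x ∷ u) (s≤s j<n) = take-! u j<n

count≡length⇒! : ∀ {σ} (a : Fin (suc σ)) u → count a u ≡ length u → ∀ {j} → j < length u → u ! j ≡ a
count≡length⇒! a (y ∷ u) e {j} j<n with y ≟ a
count≡length⇒! a (y ∷ u) e {zero} _ | yes y≡a = y≡a
count≡length⇒! a (y ∷ u) e {suc j} (s≤s j<n) | yes _ = count≡length⇒! a u (suc-injective e) j<n
... | no _ = ⊥-elim (<-irrefl e (s≤s (length-filter (_≟ a) u)))

SlowlyIncreasing : (ℕ → ℕ) → ℕ → Set
SlowlyIncreasing f m = ∀ {i} → i < m → f (suc i) ≡ f i ⊎ f (suc i) ≡ suc (f i)

slowly-monotone : ∀ {f m i} → SlowlyIncreasing f m → i < m → f i ≤ f (suc i)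
slowly-monotone inc i<m with inc i<m
... | inj₁ e = ≤-reflexive (sym e)
... | inj₂ e = ≤-trans (n≤1+n _) (≤-reflexive (sym e))

slowly-≤-index : ∀ {f m} → f 0 ≡ 0 → SlowlyIncreasing f m → ∀ {i} → i ≤ m → f i ≤ i
slowly-≤-index f0 inc {zero} _ = ≤-reflexive f0
slowly-≤-index f0 inc {suc i} i<m with inc i<m
... | inj₁ e = ≤-trans (≤-reflexive e) (m≤n⇒m≤1+n (slowly-≤-index f0 inc (<⇒≤ i<m)))
... | inj₂ e = ≤-trans (≤-reflexive e) (s≤s (slowly-≤-index f0 inc (<⇒≤ i<m)))

discrete-ivt : ∀ (F : ℕ → ℕ) {v} L → F 0 ≤ v → v ≤ F L → (∀ {j} → j < L → F (suc j) ≤ suc (F j)) →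
  ∃[ j ] (j ≤ L × F j ≡ v)
discrete-ivt F zero lo hi _ = 0 , z≤n , ≤-antisym lo hi
discrete-ivt F {v} (suc L) lo hi step with v ≤? F L
... | yes v≤FL = let (j , j≤L , e) = discrete-ivt F L lo v≤FL (λ j<L → step (m≤n⇒m≤1+n j<L))
                 in j , m≤n⇒m≤1+n j≤L , e
... | no v≰FL = suc L , ≤-refl , ≤-antisym (≤-trans (step ≤-refl) (≰⇒> v≰FL)) hi

-- The staircases i = m ∸ B j and j = m ∸ A i start at opposite corners of [0,m]², so they cross:
-- apply the discrete intermediate value theorem to j ↦ A (m ∸ B j) + j.
slowly-cross : ∀ {A B m} → A 0 ≡ 0 → B 0 ≡ 0 → SlowlyIncreasing A m → SlowlyIncreasing B m →
  ∃[ j ] ∃[ i ] (j ≤ m × i ≤ m × B j + i ≡ m × A i + j ≡ m)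
slowly-cross {A} {B} {m} A0 B0 incA incB =
  let (j , j≤m , Fj≡m) = discrete-ivt F m F0≤m (m≤n+m m _) F-step
  in j , m ∸ B j , j≤m , m∸n≤m m (B j) , m+[n∸m]≡n (B≤m j≤m) , Fj≡m
  where
  F : ℕ → ℕ
  F j = A (m ∸ B j) + j

  B≤m : ∀ {j} → j ≤ m → B j ≤ m
  B≤m j≤m = ≤-trans (slowly-≤-index B0 incB j≤m) j≤m

  F0≤m : F 0 ≤ m
  F0≤m = begin
    A (m ∸ B 0) + 0 ≡⟨ +-identityʳ _ ⟩
    A (m ∸ B 0)     ≡⟨ cong (λ b → A (m ∸ b)) B0 ⟩
    A m             ≤⟨ slowly-≤-index A0 incA ≤-refl ⟩
    m               ∎
    where open ≤-Reasoning

  F-step : ∀ {j} → j < m → F (suc j) ≤ suc (F j)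
  F-step {j} j<m with incB j<m
  ... | inj₁ e = ≤-reflexive (trans (cong (λ b → A (m ∸ b) + suc j) e) (+-suc _ j))
  ... | inj₂ e = begin
    A (m ∸ B (suc j)) + suc j       ≡⟨ cong (λ b → A (m ∸ b) + suc j) e ⟩
    A (m ∸ suc (B j)) + suc j       ≤⟨ +-monoˡ-≤ (suc j) (slowly-monotone incA x<m) ⟩
    A (suc (m ∸ suc (B j))) + suc j ≡⟨ cong (λ x → A x + suc j) (sym m∸Bj≡suc) ⟩
    A (m ∸ B j) + suc j             ≡⟨ +-suc _ j ⟩
    suc (F j)                       ∎
    where
    open ≤-Reasoning
    m∸Bj≡suc : m ∸ B j ≡ suc (m ∸ suc (B j))
    m∸Bj≡suc = +-∸-assoc 1 (≤-trans (≤-reflexive (sym e)) (B≤m j<m))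
    x<m : m ∸ suc (B j) < m
    x<m = ≤-trans (≤-reflexive (sym m∸Bj≡suc)) (m∸n≤m m (B j))

missing-letter : (x y : Fin 3) → ∃[ z ] (z ≢ x × z ≢ y)
missing-letter zero zero = suc zero , (λ ()) , (λ ())
missing-letter zero (suc zero) = suc (suc zero) , (λ ()) , (λ ())
missing-letter zero (suc (suc zero)) = suc zero , (λ ()) , (λ ())
missing-letter (suc zero) zero = suc (suc zero) , (λ ()) , (λ ())
missing-letter (suc zero) (suc zero) = zero , (λ ()) , (λ ())
missing-letter (suc zero) (suc (suc zero)) = zero , (λ ()) , (λ ())
missing-letter (suc (suc zero)) zero = suc zero , (λ ()) , (λ ())
missing-letter (suc (suc zero)) (suc zero) = zero , (λ ()) , (λ ())
missing-letter (suc (suc zero)) (suc (suc zero)) = zero , (λ ()) , (λ ())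

sum-distinct₃ : ∀ (f : Fin 3 → ℕ) {x y z} → x ≢ y → y ≢ z → x ≢ z →
  f x + f y + f z ≡ f zero + f (suc zero) + f (suc (suc zero))
sum-distinct₃ f {zero} {suc zero} {suc (suc zero)} _ _ _ = refl
sum-distinct₃ f {zero} {suc (suc zero)} {suc zero} _ _ _ = rearrange (f zero) (f (suc zero)) (f (suc (suc zero)))
  where
  rearrange : ∀ a b c → a + c + b ≡ a + b + c
  rearrange = solve-∀
sum-distinct₃ f {suc zero} {zero} {suc (suc zero)} _ _ _ = rearrange (f zero) (f (suc zero)) (f (suc (suc zero)))
  where
  rearrange : ∀ a b c → b + a + c ≡ a + b + c
  rearrange = solve-∀
sum-distinct₃ f {suc zero} {suc (suc zero)} {zero} _ _ _ = rearrange (f zero) (f (suc zero)) (f (suc (suc zero)))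
  where
  rearrange : ∀ a b c → b + c + a ≡ a + b + c
  rearrange = solve-∀
sum-distinct₃ f {suc (suc zero)} {zero} {suc zero} _ _ _ = rearrange (f zero) (f (suc zero)) (f (suc (suc zero)))
  where
  rearrange : ∀ a b c → c + a + b ≡ a + b + c
  rearrange = solve-∀
sum-distinct₃ f {suc (suc zero)} {suc zero} {zero} _ _ _ = rearrange (f zero) (f (suc zero)) (f (suc (suc zero)))
  where
  rearrange : ∀ a b c → c + b + a ≡ a + b + c
  rearrange = solve-∀
sum-distinct₃ f {zero} {zero} x≢y _ _ = ⊥-elim (x≢y refl)
sum-distinct₃ f {suc zero} {suc zero} x≢y _ _ = ⊥-elim (x≢y refl)
sum-distinct₃ f {suc (suc zero)} {suc (suc zero)} x≢y _ _ = ⊥-elim (x≢y refl)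
sum-distinct₃ f {_} {zero} {zero} _ y≢z _ = ⊥-elim (y≢z refl)
sum-distinct₃ f {_} {suc zero} {suc zero} _ y≢z _ = ⊥-elim (y≢z refl)
sum-distinct₃ f {_} {suc (suc zero)} {suc (suc zero)} _ y≢z _ = ⊥-elim (y≢z refl)
sum-distinct₃ f {zero} {_} {zero} _ _ x≢z = ⊥-elim (x≢z refl)
sum-distinct₃ f {suc zero} {_} {suc zero} _ _ x≢z = ⊥-elim (x≢z refl)
sum-distinct₃ f {suc (suc zero)} {_} {suc (suc zero)} _ _ x≢z = ⊥-elim (x≢z refl)

order-tabulate₃ : ∀ (f : Fin 3 → ℕ) → order (tabulate f) ≡ f zero + f (suc zero) + f (suc (suc zero))
order-tabulate₃ f = trans (cong (λ n → f zero + (f (suc zero) + n)) (+-identityʳ _)) (sym (+-assoc (f zero) _ _))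

count-total : (u : List (Fin 3)) → count zero u + count (suc zero) u + count (suc (suc zero)) u ≡ length u
count-total [] = refl
count-total (zero ∷ u) = cong suc (count-total u)
count-total (suc zero ∷ u) = trans (cong (_+ count (suc (suc zero)) u) (+-suc (count zero u) _)) (cong suc (count-total u))
count-total (suc (suc zero) ∷ u) = trans (+-suc _ _) (cong suc (count-total u))

count-distinct₃ : ∀ {x y z : Fin 3} → x ≢ y → y ≢ z → x ≢ z → ∀ u → count x u + count y u + count z u ≡ length u
count-distinct₃ x≢y y≢z x≢z u = trans (sum-distinct₃ (λ a → count a u) x≢y y≢z x≢z) (count-total u)

module PdBString (k : ℕ) (w : List (Fin 3)) (pdb : IsPdB (suc k) 3 w) where

  K : ℕ
  K = suc k

  Fits : ℕ → Set
  Fits s = s + K ≤ length w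

  window : ℕ → List (Fin 3)
  window s = substr s K w

  #_at_ : Fin 3 → ℕ → ℕ
  # x at s = count x (window s)

  w[_] : ℕ → Fin 3
  w[ i ] = w ! i

  window-length : ∀ {s} → Fits s → length (window s) ≡ K
  window-length {s} fits = begin
    length (take K (drop s w))   ≡⟨ length-take K (drop s w) ⟩
    K ⊓ length (drop s w)        ≡⟨ cong (K ⊓_) (length-drop s w) ⟩
    K ⊓ (length w ∸ s)           ≡⟨ m≤n⇒m⊓n≡m (m+n≤o⇒m≤o∸n K (≤-trans (≤-reflexive (+-comm K s)) fits)) ⟩
    K                            ∎
    where open ≡-Reasoning

  window-sum : ∀ {x y z s} → x ≢ y → y ≢ z → x ≢ z → Fits s → # x at s + # y at s + # z at s ≡ K
  window-sum {s = s} x≢y y≢z x≢z fits = trans (count-distinct₃ x≢y y≢z x≢z (window s)) (window-length fits)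

  order-pv-window : ∀ {s} → Fits s → order (pv (window s)) ≡ K
  order-pv-window {s} fits = trans (order-tabulate₃ (λ x → # x at s)) (trans (count-total (window s)) (window-length fits))

  window-unique : ∀ {x y s t} → x ≢ y → Fits s → Fits t →
    # x at s ≡ # x at t → # y at s ≡ # y at t → s ≡ t
  window-unique {x} {y} {s} {t} x≢y fits-s fits-t same-x same-y =
    let (_ , _ , unique) = pdb (pv (window s)) (order-pv-window fits-s)
    in trans (unique s (fits-s , refl)) (sym (unique t (fits-t , tabulate-cong (λ z → sym (same z)))))
    where
    same : ∀ z → # z at s ≡ # z at t
    same z with z ≟ x | z ≟ y
    ... | yes refl | _ = same-x
    ... | no _ | yes refl = same-y
    ... | no z≢x | no z≢y = +-cancelˡ-≡ (# x at t + # y at t) _ _ (begin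
      # x at t + # y at t + # z at s ≡⟨ cong₂ (λ a b → a + b + # z at s) same-x same-y ⟨
      # x at s + # y at s + # z at s ≡⟨ window-sum x≢y (≢-sym z≢y) (≢-sym z≢x) fits-s ⟩
      K                               ≡⟨ window-sum x≢y (≢-sym z≢y) (≢-sym z≢x) fits-t ⟨
      # x at t + # y at t + # z at t ∎)
      where open ≡-Reasoning

  pv-window≡⇒count≡ : ∀ s f → pv (window s) ≡ tabulate f → ∀ u → # u at s ≡ f u
  pv-window≡⇒count≡ s f pv≡f u = begin
    # u at s                    ≡⟨ lookup∘tabulate (λ v → # v at s) u ⟨
    lookup (pv (window s)) u    ≡⟨ cong (λ p → lookup p u) pv≡f ⟩
    lookup (tabulate f) u       ≡⟨ lookup∘tabulate f u ⟩
    f u                         ∎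
    where open ≡-Reasoning

  window-with : ∀ {x y} → x ≢ y → ∀ a b → a + b ≤ K → ∃[ s ] (Fits s × # x at s ≡ a × # y at s ≡ b)
  window-with {x} {y} x≢y a b a+b≤K =
    let (s , (fits , pv≡f) , _) = pdb (tabulate f) order≡K
    in s , fits , trans (pv-window≡⇒count≡ s f pv≡f x) f-x , trans (pv-window≡⇒count≡ s f pv≡f y) f-y
    where
    z : Fin 3
    z = proj₁ (missing-letter x y)
    z≢x : z ≢ x
    z≢x = proj₁ (proj₂ (missing-letter x y))
    z≢y : z ≢ y
    z≢y = proj₂ (proj₂ (missing-letter x y))

    f : Fin 3 → ℕ
    f u = if does (u ≟ x) then a else if does (u ≟ y) then b else K ∸ (a + b)

    f-x : f x ≡ a
    f-x rewrite dec-true (x ≟ x) refl = refl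
    f-y : f y ≡ b
    f-y rewrite dec-false (y ≟ x) (≢-sym x≢y) | dec-true (y ≟ y) refl = refl
    f-z : f z ≡ K ∸ (a + b)
    f-z rewrite dec-false (z ≟ x) z≢x | dec-false (z ≟ y) z≢y = refl

    order≡K : order (tabulate f) ≡ K
    order≡K = begin
      order (tabulate f)
        ≡⟨ order-tabulate₃ f ⟩
      f zero + f (suc zero) + f (suc (suc zero))
        ≡⟨ sum-distinct₃ f x≢y (≢-sym z≢y) (≢-sym z≢x) ⟨
      f x + f y + f z
        ≡⟨ cong₂ _+_ (cong₂ _+_ f-x f-y) f-z ⟩
      a + b + (K ∸ (a + b))
        ≡⟨ m+[n∸m]≡n a+b≤K ⟩
      K ∎
      where open ≡-Reasoning

  slide : ∀ a {s} → Fits (suc s) → # a at suc s + δ w[ s ] a ≡ # a at s + δ w[ s + K ] a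
  slide a {s} fits = begin
    count a (take K rest) + δ w[ s ] a
      ≡⟨ cong (λ v → count a v + δ w[ s ] a) (take-suc k rest k<rest) ⟩
    count a (take k rest ++ (rest ! k ∷ [])) + δ w[ s ] a
      ≡⟨ count-∷ʳ-slide a w[ s ] (rest ! k) (take k rest) ⟩
    count a (w[ s ] ∷ take k rest) + δ (rest ! k) a
      ≡⟨ cong₂ (λ v b → count a v + δ b a) (sym window-s) last ⟩
    # a at s + δ w[ s + K ] a ∎
    where
    open ≡-Reasoning
    rest : List (Fin 3)
    rest = drop (suc s) w
    k<rest : k < length rest
    k<rest = subst (k <_) (sym (length-drop (suc s) w)) (m+n≤o⇒m≤o∸n K (≤-trans (≤-reflexive (+-comm K (suc s))) fits))
    window-s : window s ≡ w[ s ] ∷ take k rest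
    window-s = cong (take K) (drop-∷ s w (m+n≤o⇒m≤o (suc s) fits))
    last : rest ! k ≡ w[ s + K ]
    last = trans (drop-! (suc s) k w) (cong w[_] (sym (+-suc s k)))

  letter-changes : ∀ {s} → Fits (suc s) → w[ s ] ≢ w[ s + K ]
  letter-changes {s} fits same = 1+n≢n (window-unique {zero} {suc zero} (λ ()) fits fits-s (same-counts _) (same-counts _))
    where
    fits-s : Fits s
    fits-s = m+n≤o⇒n≤o 1 fits
    same-counts : ∀ a → # a at suc s ≡ # a at s
    same-counts a = +-cancelʳ-≡ (δ w[ s ] a) _ _ (trans (slide a fits) (cong (λ b → # a at s + δ b a) (sym same)))

  slide-out : ∀ {x s} → Fits (suc s) → w[ s ] ≡ x → # x at suc s + 1 ≡ # x at s
  slide-out {x} {s} fits refl = begin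
    # x at suc s + 1               ≡⟨ cong (# x at suc s +_) (δ-refl x) ⟨
    # x at suc s + δ x x           ≡⟨ slide x fits ⟩
    # x at s + δ w[ s + K ] x      ≡⟨ cong (# x at s +_) (δ-≢ (≢-sym (letter-changes fits))) ⟩
    # x at s + 0                   ≡⟨ +-identityʳ _ ⟩
    # x at s                       ∎
    where open ≡-Reasoning

  slide-out-other : ∀ {x y s} → Fits (suc s) → w[ s ] ≡ x → y ≢ x → # y at suc s ≡ # y at s + δ w[ s + K ] y
  slide-out-other {x} {y} {s} fits refl y≢x = begin
    # y at suc s                   ≡⟨ +-identityʳ _ ⟨
    # y at suc s + 0               ≡⟨ cong (# y at suc s +_) (δ-≢ (≢-sym y≢x)) ⟨
    # y at suc s + δ x y           ≡⟨ slide y fits ⟩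
    # y at s + δ w[ s + K ] y      ∎
    where open ≡-Reasoning

  slide-in : ∀ {x s} → Fits (suc s) → w[ s + K ] ≡ x → # x at suc s ≡ # x at s + 1
  slide-in {x} {s} fits refl = begin
    # x at suc s                   ≡⟨ +-identityʳ _ ⟨
    # x at suc s + 0               ≡⟨ cong (# x at suc s +_) (δ-≢ (letter-changes fits)) ⟨
    # x at suc s + δ w[ s ] x      ≡⟨ slide x fits ⟩
    # x at s + δ x x               ≡⟨ cong (# x at s +_) (δ-refl x) ⟩
    # x at s + 1                   ∎
    where open ≡-Reasoning

  slide-in-other : ∀ {x y s} → Fits (suc s) → w[ s + K ] ≡ x → y ≢ x → # y at s ≡ # y at suc s + δ w[ s ] y
  slide-in-other {x} {y} {s} fits refl y≢x = begin
    # y at s                       ≡⟨ +-identityʳ _ ⟨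
    # y at s + 0                   ≡⟨ cong (# y at s +_) (δ-≢ (≢-sym y≢x)) ⟨
    # y at s + δ x y               ≡⟨ slide y fits ⟨
    # y at suc s + δ w[ s ] y      ∎
    where open ≡-Reasoning

  record Corner (x : Fin 3) (T : ℕ) : Set where
    field
      fits : Fits T
      full : # x at T ≡ K

  corner-letter : ∀ {x T p} → Corner x T → T ≤ p → p < T + K → w[ p ] ≡ x
  corner-letter {x} {T} {p} corner T≤p p<T+K = begin
    w[ p ]                    ≡⟨ cong w[_] (m+[n∸m]≡n T≤p) ⟨
    w[ T + (p ∸ T) ]          ≡⟨ drop-! T (p ∸ T) w ⟨
    drop T w ! (p ∸ T)        ≡⟨ take-! (drop T w) j<K ⟨
    window T ! (p ∸ T)        ≡⟨ count≡length⇒! x (window T) (trans full (sym (window-length fits))) j<length ⟩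
    x                         ∎
    where
    open ≡-Reasoning
    open Corner corner
    j<K : p ∸ T < K
    j<K = +-cancelˡ-< T _ _ (subst (_< T + K) (sym (m+[n∸m]≡n T≤p)) p<T+K)
    j<length : p ∸ T < length (window T)
    j<length = subst (p ∸ T <_) (sym (window-length fits)) j<K

  full-window-other : ∀ {x y s} → Fits s → # x at s ≡ K → y ≢ x → # y at s ≡ 0
  full-window-other {x} {y} {s} fits full y≢x =
    let (z , z≢x , z≢y) = missing-letter x y
    in m+n≡0⇒m≡0 _ (+-cancelˡ-≡ K _ _ (begin
      K + (# y at s + # z at s)          ≡⟨ cong (_+ (# y at s + # z at s)) full ⟨
      # x at s + (# y at s + # z at s)   ≡⟨ +-assoc (# x at s) _ _ ⟨
      # x at s + # y at s + # z at s     ≡⟨ window-sum (≢-sym y≢x) (≢-sym z≢y) (≢-sym z≢x) fits ⟩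
      K                                  ≡⟨ +-identityʳ K ⟨
      K + 0                              ∎))
    where open ≡-Reasoning

  corner-exists : ∀ x → ∃[ T ] Corner x T
  corner-exists x =
    let (y , y≢x , _) = missing-letter x x
        (T , fits , full , _) = window-with (≢-sym y≢x) K 0 (≤-reflexive (+-identityʳ K))
    in T , record { fits = fits ; full = full }

  corners-apart : ∀ {x y T T'} → x ≢ y → Corner x T → Corner y T' → T ≤ T' → T + K ≤ T'
  corners-apart {T = T} {T'} x≢y cx cy T≤T' with T + K ≤? T'
  ... | yes T+K≤T' = T+K≤T'
  ... | no T+K≰T' = ⊥-elim (x≢y (trans (sym (corner-letter cx T≤T' (≰⇒> T+K≰T'))) (corner-letter cy ≤-refl (m<m+n T' (s≤s z≤n)))))

  OnArm : (ℕ → ℕ) → ℕ → ℕ → Set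
  OnArm τ L s = ∃[ j ] (j ≤ L × τ j ≡ s)

  record Arm (x : Fin 3) (τ : ℕ → ℕ) (L : ℕ) : Set where
    field
      fits : ∀ {j} → j ≤ L → Fits (τ j)
      count-self : ∀ {j} → j ≤ L → # x at τ j + j ≡ K
      count-other : ∀ {y} → y ≢ x → SlowlyIncreasing (λ j → # y at τ j) L

  right-arm : ∀ {x T L} → Corner x T → L ≤ K → Fits (T + L) → Arm x (T +_) L
  right-arm {x} {T} {L} corner L≤K fits-end = record { fits = fits ; count-self = count-self ; count-other = count-other }
    where
    fits : ∀ {j} → j ≤ L → Fits (T + j)
    fits j≤L = ≤-trans (+-monoˡ-≤ K (+-monoʳ-≤ T j≤L)) fits-end

    fits-next : ∀ {j} → j < L → Fits (suc (T + j))
    fits-next {j} j<L = subst Fits (+-suc T j) (fits j<L)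

    leaving : ∀ {j} → j < L → w[ T + j ] ≡ x
    leaving j<L = corner-letter corner (m≤m+n _ _) (+-monoʳ-< T (≤-trans j<L L≤K))

    count-self : ∀ {j} → j ≤ L → # x at (T + j) + j ≡ K
    count-self {zero} _ = trans (+-identityʳ _) (trans (cong (#_at_ x) (+-identityʳ T)) (Corner.full corner))
    count-self {suc j} j<L = begin
      # x at (T + suc j) + suc j     ≡⟨ cong (λ s → # x at s + suc j) (+-suc T j) ⟩
      # x at suc (T + j) + suc j     ≡⟨ +-assoc (# x at suc (T + j)) 1 j ⟨
      # x at suc (T + j) + 1 + j     ≡⟨ cong (_+ j) (slide-out (fits-next j<L) (leaving j<L)) ⟩
      # x at (T + j) + j             ≡⟨ count-self (<⇒≤ j<L) ⟩
      K                              ∎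
      where open ≡-Reasoning

    count-other : ∀ {y} → y ≢ x → SlowlyIncreasing (λ j → # y at (T + j)) L
    count-other {y} y≢x {j} j<L = ≡+δ⇒≡⊎≡suc w[ T + j + K ] y
      (trans (cong (#_at_ y) (+-suc T j)) (slide-out-other (fits-next j<L) (leaving j<L) y≢x))

  left-arm : ∀ {x T L} → Corner x T → L ≤ K → L ≤ T → Arm x (T ∸_) L
  left-arm {x} {T} {L} corner L≤K L≤T = record { fits = fits ; count-self = count-self ; count-other = count-other }
    where
    fits : ∀ {j} → j ≤ L → Fits (T ∸ j)
    fits {j} _ = ≤-trans (+-monoˡ-≤ K (m∸n≤m T j)) (Corner.fits corner)

    T∸j≡suc : ∀ {j} → j < L → T ∸ j ≡ suc (T ∸ suc j)
    T∸j≡suc j<L = +-∸-assoc 1 (≤-trans j<L L≤T)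

    fits-next : ∀ {j} → j < L → Fits (suc (T ∸ suc j))
    fits-next j<L = subst Fits (T∸j≡suc j<L) (fits (<⇒≤ j<L))

    approaching : ∀ {j} → j < L → w[ T ∸ suc j + K ] ≡ x
    approaching {j} j<L = corner-letter corner T≤ (+-monoˡ-< K (≤-trans (≤-reflexive (sym (T∸j≡suc j<L))) (m∸n≤m T j)))
      where
      T≤ : T ≤ T ∸ suc j + K
      T≤ = ≤-trans (≤-reflexive (sym (m∸n+n≡m (≤-trans j<L L≤T)))) (+-monoʳ-≤ (T ∸ suc j) (≤-trans j<L L≤K))

    count-self : ∀ {j} → j ≤ L → # x at (T ∸ j) + j ≡ K
    count-self {zero} _ = trans (+-identityʳ _) (Corner.full corner)
    count-self {suc j} j<L = begin
      # x at (T ∸ suc j) + suc j       ≡⟨ +-suc _ j ⟩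
      suc (# x at (T ∸ suc j)) + j     ≡⟨ cong (_+ j) (+-comm 1 _) ⟩
      # x at (T ∸ suc j) + 1 + j       ≡⟨ cong (_+ j) (slide-in (fits-next j<L) (approaching j<L)) ⟨
      # x at suc (T ∸ suc j) + j       ≡⟨ cong (λ s → # x at s + j) (T∸j≡suc j<L) ⟨
      # x at (T ∸ j) + j               ≡⟨ count-self (<⇒≤ j<L) ⟩
      K                                ∎
      where open ≡-Reasoning

    count-other : ∀ {y} → y ≢ x → SlowlyIncreasing (λ j → # y at (T ∸ j)) L
    count-other {y} y≢x {j} j<L = ≡+δ⇒≡⊎≡suc w[ T ∸ suc j ] y
      (trans (slide-in-other (fits-next j<L) (approaching j<L) y≢x) (cong (λ s → # y at s + δ w[ T ∸ suc j ] y) (sym (T∸j≡suc j<L))))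

  arms-cross : ∀ {x y τ σ} → x ≢ y → Arm x τ K → Arm y σ K → ∃[ j ] ∃[ i ] (j ≤ K × i ≤ K × τ j ≡ σ i)
  arms-cross {x} {y} {τ} {σ} x≢y arm-x arm-y =
    let (j , i , j≤K , i≤K , y-τ+i≡K , x-σ+j≡K) =
          slowly-cross (starts-empty arm-y x≢y) (starts-empty arm-x (≢-sym x≢y))
                       (Arm.count-other arm-y x≢y) (Arm.count-other arm-x (≢-sym x≢y))
    in j , i , j≤K , i≤K ,
       window-unique x≢y (Arm.fits arm-x j≤K) (Arm.fits arm-y i≤K)
         (+-cancelʳ-≡ j _ _ (trans (Arm.count-self arm-x j≤K) (sym x-σ+j≡K)))
         (+-cancelʳ-≡ i _ _ (trans y-τ+i≡K (sym (Arm.count-self arm-y i≤K))))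
    where
    starts-empty : ∀ {a b ρ} → Arm a ρ K → b ≢ a → # b at ρ 0 ≡ 0
    starts-empty arm b≢a = full-window-other (Arm.fits arm z≤n) (trans (sym (+-identityʳ _)) (Arm.count-self arm z≤n)) b≢a

  right-arms-meet : ∀ {x y T T'} → x ≢ y → Corner x T → Corner y T' → Fits (T + K) → Fits (T' + K) → T' ≤ T + K
  right-arms-meet {T = T} {T'} x≢y cx cy fits fits' =
    let (j , i , j≤K , _ , T+j≡T'+i) = arms-cross x≢y (right-arm cx ≤-refl fits) (right-arm cy ≤-refl fits')
    in ≤-trans (m≤m+n T' i) (≤-trans (≤-reflexive (sym T+j≡T'+i)) (+-monoʳ-≤ T j≤K))

  left-arms-meet : ∀ {x y T T'} → x ≢ y → Corner x T → Corner y T' → K ≤ T → K ≤ T' → T' ≤ T + K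
  left-arms-meet {T = T} {T'} x≢y cx cy K≤T K≤T' =
    let (j , i , _ , i≤K , T∸j≡T'∸i) = arms-cross x≢y (left-arm cx ≤-refl K≤T) (left-arm cy ≤-refl K≤T')
    in begin
      T'            ≡⟨ m∸n+n≡m (≤-trans i≤K K≤T') ⟨
      T' ∸ i + i    ≡⟨ cong (_+ i) T∸j≡T'∸i ⟨
      T ∸ j + i     ≤⟨ +-mono-≤ (m∸n≤m T j) i≤K ⟩
      T + K         ∎
    where open ≤-Reasoning

  -- Between adjacent corners of x and y the window at T + d is x^(K ∸ d) y^d.
  between-corners : ∀ {x y z T s} → x ≢ y → y ≢ z → x ≢ z → Corner x T → Corner y (T + K) →
    T ≤ s → s ≤ T + K → # z at s ≡ 0
  between-corners {x} {y} {z} {T} {s} x≢y y≢z x≢z cx cy T≤s s≤T+K =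
    subst (λ t → # z at t ≡ 0) (m+[n∸m]≡n T≤s) (+-cancelˡ-≡ K _ _ (begin
    K + # z at (T + d)                                ≡⟨ cong (_+ # z at (T + d)) x+y≡K ⟨
    # x at (T + d) + # y at (T + d) + # z at (T + d)  ≡⟨ window-sum x≢y y≢z x≢z (Arm.fits from-x d≤K) ⟩
    K                                                 ≡⟨ +-identityʳ K ⟨
    K + 0                                             ∎))
    where
    open ≡-Reasoning
    d : ℕ
    d = s ∸ T
    d≤K : d ≤ K
    d≤K = ≤-trans (∸-monoˡ-≤ T s≤T+K) (≤-reflexive (m+n∸m≡n T K))
    from-x : Arm x (T +_) K
    from-x = right-arm cx ≤-refl (Corner.fits cy)
    to-y : Arm y ((T + K) ∸_) K
    to-y = left-arm cy ≤-refl (m≤n+m K T)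
    position : T + K ∸ (K ∸ d) ≡ T + d
    position = trans (+-∸-assoc T (m∸n≤m K d)) (cong (T +_) (m∸[m∸n]≡n d≤K))
    y≡d : # y at (T + d) ≡ d
    y≡d = +-cancelʳ-≡ (K ∸ d) _ _ (begin
      # y at (T + d) + (K ∸ d)           ≡⟨ cong (λ s → # y at s + (K ∸ d)) position ⟨
      # y at (T + K ∸ (K ∸ d)) + (K ∸ d) ≡⟨ Arm.count-self to-y (m∸n≤m K d) ⟩
      K                                  ≡⟨ m+[n∸m]≡n d≤K ⟨
      d + (K ∸ d)                        ∎)
    x+y≡K : # x at (T + d) + # y at (T + d) ≡ K
    x+y≡K = trans (cong (# x at (T + d) +_) y≡d) (Arm.count-self from-x d≤K)

  arm-injective : ∀ {x τ L s s'} → Arm x τ L → OnArm τ L s → OnArm τ L s' → # x at s ≡ # x at s' → s ≡ s'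
  arm-injective {x} {τ} arm (j , j≤L , refl) (j' , j'≤L , refl) same = cong τ (+-cancelˡ-≡ (# x at τ j) j j' (begin
    # x at τ j + j     ≡⟨ Arm.count-self arm j≤L ⟩
    K                  ≡⟨ Arm.count-self arm j'≤L ⟨
    # x at τ j' + j'   ≡⟨ cong (_+ j') same ⟨
    # x at τ j + j'    ∎))
    where open ≡-Reasoning

  Covers : Fin 3 → Fin 3 → (ℕ → ℕ) → ℕ → (ℕ → ℕ) → ℕ → Set
  Covers x z τ L σ M = ∀ {s} → Fits s → 1 ≤ # x at s → 1 ≤ # z at s → OnArm τ L s ⊎ OnArm σ M s

  n≡suc⇒1≤n : ∀ {n m} → n ≡ suc m → 1 ≤ n
  n≡suc⇒1≤n refl = s≤s z≤n

  -- Following the windows with (x, z)-counts (2, 2), (2, 1), (1, 1): each one is forced onto the other arm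
  -- than the previous, and the last lands next to the first on τ, where the z-count cannot drop.
  two-two-off-first-arm : ∀ {x z τ L σ M s} → 2 ≤ k → x ≢ z → Arm x τ L → Arm z σ M → Covers x z τ L σ M →
    OnArm τ L s → # x at s ≡ 2 → # z at s ≡ 2 → ⊥
  two-two-off-first-arm {x} {z} {τ} {L} {σ} {M} 2≤k x≢z arm-x arm-z covers p-on-τ@(j , j≤L , refl) xp≡2 zp≡2
    with window-with x≢z 2 1 (s≤s 2≤k) | window-with x≢z 1 1 (s≤s (m+n≤o⇒n≤o 1 2≤k))
  ... | q , fits-q , xq≡2 , zq≡1 | r , fits-r , xr≡1 , zr≡1 =
    [ q-on-τ , q-on-σ ] (covers fits-q (n≡suc⇒1≤n xq≡2) (n≡suc⇒1≤n zq≡1))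
    where
    q-on-τ : OnArm τ L q → ⊥
    q-on-τ on = 1+n≢n (begin
      2               ≡⟨ zp≡2 ⟨
      # z at τ j      ≡⟨ cong (#_at_ z) (arm-injective arm-x p-on-τ on (trans xp≡2 (sym xq≡2))) ⟩
      # z at q        ≡⟨ zq≡1 ⟩
      1               ∎)
      where open ≡-Reasoning

    r-on-τ : OnArm τ L r → ⊥
    r-on-τ (j' , j'≤L , refl) = <⇒≱ (s≤s (s≤s z≤n)) (begin
      2                  ≡⟨ zp≡2 ⟨
      # z at τ j         ≤⟨ slowly-monotone (Arm.count-other arm-x (≢-sym x≢z)) j<L ⟩
      # z at τ (suc j)   ≡⟨ cong (λ i → # z at τ i) j'≡suc-j ⟨
      # z at τ j'        ≡⟨ zr≡1 ⟩
      1                  ∎)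
      where
      open ≤-Reasoning
      j'≡suc-j : j' ≡ suc j
      j'≡suc-j = +-cancelˡ-≡ 1 j' (suc j) (begin-equality
        1 + j'             ≡⟨ cong (_+ j') xr≡1 ⟨
        # x at τ j' + j'   ≡⟨ Arm.count-self arm-x j'≤L ⟩
        K                  ≡⟨ Arm.count-self arm-x j≤L ⟨
        # x at τ j + j     ≡⟨ cong (_+ j) xp≡2 ⟩
        2 + j              ∎)
      j<L : j < L
      j<L = subst (_≤ L) j'≡suc-j j'≤L

    q-on-σ : OnArm σ M q → ⊥
    q-on-σ q-on = [ r-on-τ , r-on-σ ] (covers fits-r (n≡suc⇒1≤n xr≡1) (n≡suc⇒1≤n zr≡1))
      where
      r-on-σ : OnArm σ M r → ⊥
      r-on-σ on = 1+n≢n (begin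
        2               ≡⟨ xq≡2 ⟨
        # x at q        ≡⟨ cong (#_at_ x) (arm-injective arm-z q-on on (trans zq≡1 (sym zr≡1))) ⟩
        # x at r        ≡⟨ xr≡1 ⟩
        1               ∎)
        where open ≡-Reasoning

  arms-cannot-cover : ∀ {x z τ L σ M} → 3 ≤ k → x ≢ z → Arm x τ L → Arm z σ M → Covers x z τ L σ M → ⊥
  arms-cannot-cover 3≤k x≢z arm-x arm-z covers with window-with x≢z 2 2 (s≤s 3≤k)
  ... | p , fits-p , xp≡2 , zp≡2 =
    [ (λ on → two-two-off-first-arm 2≤k x≢z arm-x arm-z covers on xp≡2 zp≡2)
    , (λ on → two-two-off-first-arm 2≤k (≢-sym x≢z) arm-z arm-x (λ fits 1≤z 1≤x → swap (covers fits 1≤x 1≤z)) on zp≡2 xp≡2)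
    ] (covers fits-p (n≡suc⇒1≤n xp≡2) (n≡suc⇒1≤n zp≡2))
    where
    2≤k : 2 ≤ k
    2≤k = m+n≤o⇒n≤o 1 3≤k

  adjacent-corners : ∀ {x y z T₁ T₂ T₃} → x ≢ y → y ≢ z → Corner x T₁ → Corner y T₂ → Corner z T₃ →
    T₁ ≤ T₂ → T₂ ≤ T₃ → T₂ ≡ T₁ + K × T₃ ≡ T₂ + K
  adjacent-corners {T₁ = T₁} {T₂} {T₃} x≢y y≢z c₁ c₂ c₃ T₁≤T₂ T₂≤T₃ =
      ≤-antisym (right-arms-meet x≢y c₁ c₂ (≤-trans (+-monoˡ-≤ K apart₁₂) (Corner.fits c₂))
                                           (≤-trans (+-monoˡ-≤ K apart₂₃) (Corner.fits c₃))) apart₁₂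
    , ≤-antisym (left-arms-meet y≢z c₂ c₃ (m+n≤o⇒n≤o T₁ apart₁₂) (m+n≤o⇒n≤o T₂ apart₂₃)) apart₂₃
    where
    apart₁₂ : T₁ + K ≤ T₂
    apart₁₂ = corners-apart x≢y c₁ c₂ T₁≤T₂
    apart₂₃ : T₂ + K ≤ T₃
    apart₂₃ = corners-apart y≢z c₂ c₃ T₂≤T₃

  far-corners-near-ends : ∀ {x z T T'} → x ≢ z → Corner x T → Corner z T' → T + K < T' → T < K × ¬ Fits (T' + K)
  far-corners-near-ends {T = T} {T'} x≢z cx cz T+K<T' =
      ≰⇒> (λ K≤T → <⇒≱ T+K<T' (left-arms-meet x≢z cx cz K≤T (m+n≤o⇒n≤o T (<⇒≤ T+K<T'))))
    , (λ fits → <⇒≱ T+K<T' (right-arms-meet x≢z cx cz (≤-trans (+-monoˡ-≤ K (<⇒≤ T+K<T')) (Corner.fits cz)) fits))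

  room : ℕ → ℕ
  room T = length w ∸ (T + K)

  fits-room : ∀ {T} → Fits T → Fits (T + room T)
  fits-room {T} fits = ≤-reflexive (begin
    T + room T + K        ≡⟨ +-assoc T (room T) K ⟩
    T + (room T + K)      ≡⟨ cong (T +_) (+-comm (room T) K) ⟩
    T + (K + room T)      ≡⟨ +-assoc T K (room T) ⟨
    T + K + room T        ≡⟨ m+[n∸m]≡n fits ⟩
    length w              ∎)
    where open ≡-Reasoning

  room≤K : ∀ {T} → ¬ Fits (T + K) → room T ≤ K
  room≤K {T} ¬fits = ≤-trans (∸-monoˡ-≤ (T + K) (<⇒≤ (≰⇒> ¬fits))) (≤-reflexive (m+n∸m≡n (T + K) K))

  offset≤room : ∀ {T s} → T ≤ s → Fits s → s ∸ T ≤ room T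
  offset≤room {T} {s} T≤s fits = m+n≤o⇒m≤o∸n (s ∸ T) (begin
    s ∸ T + (T + K)       ≡⟨ +-assoc (s ∸ T) T K ⟨
    s ∸ T + T + K         ≡⟨ cong (_+ K) (m∸n+n≡m T≤s) ⟩
    s + K                 ≤⟨ fits ⟩
    length w              ∎)
    where open ≤-Reasoning

  two-letter-windows : ∀ {x₁ x₂ x₃ T} → x₁ ≢ x₂ → x₂ ≢ x₃ → x₁ ≢ x₃ →
    Corner x₁ T → Corner x₂ (T + K) → Corner x₃ (T + K + K) →
    Covers x₁ x₃ (T ∸_) T ((T + K + K) +_) (room (T + K + K))
  two-letter-windows {T = T} x₁≢x₂ x₂≢x₃ x₁≢x₃ c₁ c₂ c₃ {s} fits 1≤x₁ 1≤x₃ with s ≤? T | T + K + K ≤? s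
  ... | yes s≤T | _ = inj₁ (T ∸ s , m∸n≤m T s , m∸[m∸n]≡n s≤T)
  ... | no _ | yes T₃≤s = inj₂ (s ∸ (T + K + K) , offset≤room T₃≤s fits , m+[n∸m]≡n T₃≤s)
  ... | no s≰T | no T₃≰s with s ≤? T + K
  ...   | yes s≤T+K = ⊥-elim (<⇒≱ 1≤x₃ (≤-reflexive
          (between-corners x₁≢x₂ x₂≢x₃ x₁≢x₃ c₁ c₂ (<⇒≤ (≰⇒> s≰T)) s≤T+K)))
  ...   | no s≰T+K = ⊥-elim (<⇒≱ 1≤x₁ (≤-reflexive
          (between-corners x₂≢x₃ (≢-sym x₁≢x₃) (≢-sym x₁≢x₂) c₂ c₃ (<⇒≤ (≰⇒> s≰T+K)) (<⇒≤ (≰⇒> T₃≰s)))))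

  sorted-corners-impossible : ∀ {x₁ x₂ x₃ T₁ T₂ T₃} → 3 ≤ k → x₁ ≢ x₂ → x₂ ≢ x₃ → x₁ ≢ x₃ →
    Corner x₁ T₁ → Corner x₂ T₂ → Corner x₃ T₃ → T₁ ≤ T₂ → T₂ ≤ T₃ → ⊥
  sorted-corners-impossible {x₂ = x₂} {x₃} {T₁} {T₂} {T₃} 3≤k x₁≢x₂ x₂≢x₃ x₁≢x₃ c₁ c₂ c₃ T₁≤T₂ T₂≤T₃ =
    arms-cannot-cover 3≤k x₁≢x₃ (left-arm c₁ (<⇒≤ (proj₁ outer)) ≤-refl)
      (right-arm c₃′ (room≤K (proj₂ outer)) (fits-room (Corner.fits c₃′)))
      (two-letter-windows x₁≢x₂ x₂≢x₃ x₁≢x₃ c₁ c₂′ c₃′)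
    where
    adjacent : T₂ ≡ T₁ + K × T₃ ≡ T₂ + K
    adjacent = adjacent-corners x₁≢x₂ x₂≢x₃ c₁ c₂ c₃ T₁≤T₂ T₂≤T₃
    c₂′ : Corner x₂ (T₁ + K)
    c₂′ = subst (Corner x₂) (proj₁ adjacent) c₂
    c₃′ : Corner x₃ (T₁ + K + K)
    c₃′ = subst (Corner x₃) (trans (proj₂ adjacent) (cong (_+ K) (proj₁ adjacent))) c₃
    outer : T₁ < K × ¬ Fits (T₁ + K + K + K)
    outer = far-corners-near-ends x₁≢x₃ c₁ c₃′ (m<m+n (T₁ + K) (s≤s z≤n))

  no-pdb : 3 ≤ k → ⊥
  no-pdb 3≤k with corner-exists zero | corner-exists (suc zero) | corner-exists (suc (suc zero))
  ... | T₀ , c₀ | T₁ , c₁ | T₂ , c₂ with ≤-total T₀ T₁ | ≤-total T₁ T₂ | ≤-total T₀ T₂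
  ... | inj₁ T₀≤T₁ | inj₁ T₁≤T₂ | _          = sorted-corners-impossible 3≤k (λ ()) (λ ()) (λ ()) c₀ c₁ c₂ T₀≤T₁ T₁≤T₂
  ... | inj₁ T₀≤T₁ | inj₂ T₂≤T₁ | inj₁ T₀≤T₂ = sorted-corners-impossible 3≤k (λ ()) (λ ()) (λ ()) c₀ c₂ c₁ T₀≤T₂ T₂≤T₁
  ... | inj₁ T₀≤T₁ | inj₂ T₂≤T₁ | inj₂ T₂≤T₀ = sorted-corners-impossible 3≤k (λ ()) (λ ()) (λ ()) c₂ c₀ c₁ T₂≤T₀ T₀≤T₁
  ... | inj₂ T₁≤T₀ | inj₁ T₁≤T₂ | inj₁ T₀≤T₂ = sorted-corners-impossible 3≤k (λ ()) (λ ()) (λ ()) c₁ c₀ c₂ T₁≤T₀ T₀≤T₂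
  ... | inj₂ T₁≤T₀ | inj₁ T₁≤T₂ | inj₂ T₂≤T₀ = sorted-corners-impossible 3≤k (λ ()) (λ ()) (λ ()) c₁ c₂ c₀ T₁≤T₂ T₂≤T₀
  ... | inj₂ T₁≤T₀ | inj₂ T₂≤T₁ | _          = sorted-corners-impossible 3≤k (λ ()) (λ ()) (λ ()) c₂ c₁ c₀ T₂≤T₁ T₁≤T₀

theorem5 : (k : ℕ) → 4 ≤ k → (w : List (Fin 3)) → ¬ IsPdB k 3 w
theorem5 (suc k) (s≤s 3≤k) w pdb = PdBString.no-pdb k w pdb 3≤k
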